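{- Let $K$ be a real quadratic number field with a $\mathbb{Z}$-basis $\beta_1,\beta_2\in\mathfrak{O}_K^+$ of $\mathfrak{O}_K$, and suppose $\alpha=a_2\beta_2-a_1\beta_1\in\mathfrak{O}_K^+$ with $a_1,a_2\in\mathbb{N}$ nonzero. Let $q,r\in\mathbb{N}$ with $0\leqslant r\leqslant a_1$ and set $y_1=a_1q+r$. Let $y_2\in\mathbb{Z}$. Then: (a) if $0<r<a_1$, then $y_2\beta_2-y_1\beta_1\in\mathrm{SG}(\beta_1,\beta_2,\alpha)$ if and only if $y_2\geqslant(q+1)a_2$; (b) if $r=0$ (so $y_1=qa_1$), then $y_2\beta_2-y_1\beta_1\in\mathrm{SG}(\beta_1,\beta_2,\alpha)$ if and only if $y_2\geqslant qa_2$.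
   Context: A real quadratic number field is a degree-2 number field contained in $\mathbb{R}$; $\mathfrak{O}_K$ is its ring of integers and $\mathfrak{O}_K^+=\mathfrak{O}_K\cap[0,\infty)$. $\mathbb{N}=\{0,1,2,\dots\}$. $\mathrm{SG}(\gamma_1,\dots,\gamma_k)=\{\sum x_i\gamma_i\mid x_i\in\mathbb{N}\}$. -}

module Defs where

open import Data.Nat as ℕ using (ℕ; _%_)
open import Data.Integer as ℤ using (ℤ; +_; 0ℤ; 1ℤ)
open import Data.Integer.Divisibility as ℤD using ()
open import Data.Nat.Divisibility as ℕD using ()
open import Data.Product using (_×_; _,_; ∃-syntax)
open import Data.Sum using (_⊎_)
open import Relation.Binary.PropositionalEquality using (_≡_; _≢_)

-- A real quadratic number field is K = ℚ(√D) for a unique squarefree D > 1,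
-- embedded in ℝ with √D > 0.
SquareFree : ℕ → Set
SquareFree D = ∀ p → (p ℕ.* p) ℕD.∣ D → p ≡ 1

RealQuadratic : ℕ → Set
RealQuadratic D = (1 ℕ.< D) × SquareFree D

-- Every element of 𝔒_K is (u + v√D)/2 with u v ∈ ℤ; we represent it by the
-- pair (u , v).  This representation is unique (1, √D are ℚ-independent),
-- so equality of elements is _≡_ on pairs.
Elt : Set
Elt = ℤ × ℤ

InO : ℕ → Elt → Set
InO D (u , v) =
  (D % 4 ≡ 1 × + 2 ℤD.∣ (u ℤ.- v)) ⊎
  (D % 4 ≢ 1 × + 2 ℤD.∣ u × + 2 ℤD.∣ v)

-- (u + v√D)/2 ≥ 0 in ℝ (written out by comparing squares)
NonNeg : ℕ → Elt → Set
NonNeg D (u , v) =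
  (0ℤ ℤ.≤ u × 0ℤ ℤ.≤ v) ⊎
  ((0ℤ ℤ.≤ u × v ℤ.< 0ℤ × (v ℤ.* v) ℤ.* + D ℤ.≤ u ℤ.* u) ⊎
   (u ℤ.< 0ℤ × 0ℤ ℤ.≤ v × u ℤ.* u ℤ.≤ (v ℤ.* v) ℤ.* + D))

InO⁺ : ℕ → Elt → Set
InO⁺ D γ = InO D γ × NonNeg D γ

infixl 6 _⊕_ _⊖_
infixl 7 _·_

_⊕_ : Elt → Elt → Elt
(a , b) ⊕ (c , d) = (a ℤ.+ c , b ℤ.+ d)

_⊖_ : Elt → Elt → Elt
(a , b) ⊖ (c , d) = (a ℤ.- c , b ℤ.- d)

_·_ : ℤ → Elt → Elt
n · (a , b) = (n ℤ.* a , n ℤ.* b)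

IsZBasis : ℕ → Elt → Elt → Set
IsZBasis D β₁ β₂ =
  InO D β₁ × InO D β₂ ×
  (∀ γ → InO D γ → ∃[ m ] ∃[ n ] γ ≡ m · β₁ ⊕ n · β₂) ×
  (∀ m n m′ n′ → m · β₁ ⊕ n · β₂ ≡ m′ · β₁ ⊕ n′ · β₂ → m ≡ m′ × n ≡ n′)

InSG₃ : Elt → Elt → Elt → Elt → Set
InSG₃ γ₁ γ₂ γ₃ δ =
  ∃[ x₁ ] ∃[ x₂ ] ∃[ x₃ ] δ ≡ (+ x₁) · γ₁ ⊕ (+ x₂) · γ₂ ⊕ (+ x₃) · γ₃

{-# OPTIONS --safe #-}
module Submission where

-- In the basis β₁, β₂ the element x₁β₁ + x₂β₂ + x₃α has coordinates (x₁ − a₁x₃, x₂ + a₂x₃),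
-- so by uniqueness of coordinates y₂β₂ − y₁β₁ lies in SG(β₁, β₂, α) iff some x ∈ ℕ has
-- y₁ ≤ a₁x and a₂x ≤ y₂. As a₂x grows with x, it suffices to test the least x with
-- y₁ ≤ a₁x, namely ⌈y₁/a₁⌉, which is q + 1 if r > 0 and q if r = 0.

open import Defs
open import Data.Nat using (ℕ; NonZero)
open import Data.Nat as ℕ using ()
open import Data.Integer using (ℤ; +_; _+_; _-_; _*_; -_; ∣_∣; _≤_)
open import Data.Integer as ℤ using ()
open import Data.Integer.Tactic.RingSolver using (solve-∀)
import Data.Integer.Properties as ℤP
import Data.Nat.Properties as ℕP
open import Data.Product using (_×_; _,_; ∃-syntax; map₁)
open import Function.Bundles using (_⇔_; mk⇔; Equivalence)
import Function.Properties.Equivalence as ⇔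
open import Relation.Binary.PropositionalEquality
  using (_≡_; refl; sym; trans; cong; cong₂; subst; module ≡-Reasoning)

module _ {i j : ℤ} (i≤j : i ≤ j) where

  private
    +∣j-i∣≡j-i : + ∣ j - i ∣ ≡ j - i
    +∣j-i∣≡j-i = ℤP.0≤i⇒+∣i∣≡i (ℤP.i≤j⇒0≤j-i i≤j)

  i≤j⇒j≡i+∣j-i∣ : j ≡ i + + ∣ j - i ∣
  i≤j⇒j≡i+∣j-i∣ = trans (add-back i j) (cong (λ k → i + k) (sym +∣j-i∣≡j-i))
    where
    add-back : ∀ i j → j ≡ i + (j - i)
    add-back = solve-∀

  i≤j⇒i≡j-∣j-i∣ : i ≡ j - + ∣ j - i ∣
  i≤j⇒i≡j-∣j-i∣ = trans (take-away i j) (cong (λ k → j - k) (sym +∣j-i∣≡j-i))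
    where
    take-away : ∀ i j → i ≡ j - (j - i)
    take-away = solve-∀

+≤+*+⇔≤* : ∀ m a x → + m ≤ + a * + x ⇔ m ℕ.≤ a ℕ.* x
+≤+*+⇔≤* m a x rewrite sym (ℤP.pos-* a x) = mk⇔ ℤP.drop‿+≤+ ℤ.+≤+

a*q+r≤a*x⇔q+1≤x : ∀ a q {r} x → 0 ℕ.< r → r ℕ.≤ a → a ℕ.* q ℕ.+ r ℕ.≤ a ℕ.* x ⇔ q ℕ.+ 1 ℕ.≤ x
a*q+r≤a*x⇔q+1≤x a q {r} x 0<r r≤a = mk⇔ to from
  where
  open ℕP.≤-Reasoning
  a*[q+1]≡a*q+a : a ℕ.* (q ℕ.+ 1) ≡ a ℕ.* q ℕ.+ a
  a*[q+1]≡a*q+a = trans (cong (a ℕ.*_) (ℕP.+-comm q 1)) (trans (ℕP.*-suc a q) (ℕP.+-comm a (a ℕ.* q)))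

  to : a ℕ.* q ℕ.+ r ℕ.≤ a ℕ.* x → q ℕ.+ 1 ℕ.≤ x
  to a*q+r≤a*x = subst (ℕ._≤ x) (ℕP.+-comm 1 q)
    (ℕP.*-cancelˡ-< a q x (ℕP.<-≤-trans (ℕP.m<m+n (a ℕ.* q) 0<r) a*q+r≤a*x))

  from : q ℕ.+ 1 ℕ.≤ x → a ℕ.* q ℕ.+ r ℕ.≤ a ℕ.* x
  from q+1≤x = begin
    a ℕ.* q ℕ.+ r       ≤⟨ ℕP.+-monoʳ-≤ (a ℕ.* q) r≤a ⟩
    a ℕ.* q ℕ.+ a       ≡⟨ a*[q+1]≡a*q+a ⟨
    a ℕ.* (q ℕ.+ 1)     ≤⟨ ℕP.*-monoʳ-≤ a q+1≤x ⟩
    a ℕ.* x             ∎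

a*q≤a*x⇔q≤x : ∀ a .{{_ : NonZero a}} q x → a ℕ.* q ℕ.≤ a ℕ.* x ⇔ q ℕ.≤ x
a*q≤a*x⇔q≤x a q x = mk⇔ (ℕP.*-cancelˡ-≤ a) (ℕP.*-monoʳ-≤ a)

∃-above-threshold⇔ : ∀ {P : ℕ → Set} x₀ → (∀ x → P x ⇔ x₀ ℕ.≤ x) → ∀ a y →
  (∃[ x ] P x × + a * + x ≤ y) ⇔ + (x₀ ℕ.* a) ≤ y
∃-above-threshold⇔ {P} x₀ P⇔x₀≤ a y = mk⇔ to from
  where
  open ℤP.≤-Reasoning
  a*x₀≡x₀*a : + a * + x₀ ≡ + (x₀ ℕ.* a)
  a*x₀≡x₀*a = trans (sym (ℤP.pos-* a x₀)) (cong +_ (ℕP.*-comm a x₀))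

  to : ∃[ x ] P x × + a * + x ≤ y → + (x₀ ℕ.* a) ≤ y
  to (x , Px , a*x≤y) = begin
    + (x₀ ℕ.* a)  ≡⟨ a*x₀≡x₀*a ⟨
    + a * + x₀    ≤⟨ ℤP.*-monoˡ-≤-nonNeg (+ a) (ℤ.+≤+ (Equivalence.to (P⇔x₀≤ x) Px)) ⟩
    + a * + x     ≤⟨ a*x≤y ⟩
    y             ∎

  from : + (x₀ ℕ.* a) ≤ y → ∃[ x ] P x × + a * + x ≤ y
  from x₀*a≤y =
    x₀ , Equivalence.from (P⇔x₀≤ x₀) ℕP.≤-refl , subst (_≤ y) (sym a*x₀≡x₀*a) x₀*a≤y

Independent : Elt → Elt → Set
Independent β₁ β₂ =
  ∀ m n m′ n′ → m · β₁ ⊕ n · β₂ ≡ m′ · β₁ ⊕ n′ · β₂ → m ≡ m′ × n ≡ n′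

⊖-injective : ∀ {β₁ β₂} → Independent β₁ β₂ →
              ∀ m n m′ n′ → n · β₂ ⊖ m · β₁ ≡ n′ · β₂ ⊖ m′ · β₁ → m ≡ m′ × n ≡ n′
⊖-injective {β₁@(b , c)} {β₂@(d , e)} indep m n m′ n′ eq =
  map₁ ℤP.neg-injective (indep (- m) n (- m′) n′ (trans (sym (⊖-as-⊕ m n)) (trans eq (⊖-as-⊕ m′ n′))))
  where
  swap : ∀ m n b d → n * d - m * b ≡ (- m) * b + n * d
  swap = solve-∀
  ⊖-as-⊕ : ∀ m n → n · β₂ ⊖ m · β₁ ≡ (- m) · β₁ ⊕ n · β₂
  ⊖-as-⊕ m n = cong₂ _,_ (swap m n b d) (swap m n c e)

combination-in-basis : ∀ β₁ β₂ a₁ a₂ x₁ x₂ x₃ →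
  x₁ · β₁ ⊕ x₂ · β₂ ⊕ x₃ · (a₂ · β₂ ⊖ a₁ · β₁) ≡ (a₂ * x₃ + x₂) · β₂ ⊖ (a₁ * x₃ - x₁) · β₁
combination-in-basis (b , c) (d , e) a₁ a₂ x₁ x₂ x₃ =
  cong₂ _,_ (regroup x₁ x₂ x₃ a₁ a₂ b d) (regroup x₁ x₂ x₃ a₁ a₂ c e)
  where
  regroup : ∀ x₁ x₂ x₃ a₁ a₂ b d →
    x₁ * b + x₂ * d + x₃ * (a₂ * d - a₁ * b) ≡ (a₂ * x₃ + x₂) * d - (a₁ * x₃ - x₁) * b
  regroup = solve-∀

InSG₃-α⇔ : ∀ {β₁ β₂} → Independent β₁ β₂ → ∀ a₁ a₂ m n →
  InSG₃ β₁ β₂ (a₂ · β₂ ⊖ a₁ · β₁) (n · β₂ ⊖ m · β₁) ⇔ (∃[ x ] m ≤ a₁ * + x × a₂ * + x ≤ n)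
InSG₃-α⇔ {β₁} {β₂} indep a₁ a₂ m n = mk⇔ to from
  where
  to : InSG₃ β₁ β₂ (a₂ · β₂ ⊖ a₁ · β₁) (n · β₂ ⊖ m · β₁) → ∃[ x ] m ≤ a₁ * + x × a₂ * + x ≤ n
  to (x₁ , x₂ , x₃ , eq)
    with ⊖-injective indep m n (a₁ * + x₃ - + x₁) (a₂ * + x₃ + + x₂)
           (trans eq (combination-in-basis β₁ β₂ a₁ a₂ (+ x₁) (+ x₂) (+ x₃)))
  ... | refl , refl = x₃ , ℤP.i≤j⇒i-k≤j (+ x₁) ℤP.≤-refl , ℤP.i≤i+j _ (+ x₂)

  from : ∃[ x ] m ≤ a₁ * + x × a₂ * + x ≤ n → InSG₃ β₁ β₂ (a₂ · β₂ ⊖ a₁ · β₁) (n · β₂ ⊖ m · β₁)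
  from (x , m≤a₁x , a₂x≤n) = x₁ , x₂ , x , (begin
      n · β₂ ⊖ m · β₁
    ≡⟨ cong₂ (λ n m → n · β₂ ⊖ m · β₁) (i≤j⇒j≡i+∣j-i∣ a₂x≤n) (i≤j⇒i≡j-∣j-i∣ m≤a₁x) ⟩
      (a₂ * + x + + x₂) · β₂ ⊖ (a₁ * + x - + x₁) · β₁
    ≡⟨ sym (combination-in-basis β₁ β₂ a₁ a₂ (+ x₁) (+ x₂) (+ x)) ⟩
      + x₁ · β₁ ⊕ + x₂ · β₂ ⊕ + x · (a₂ · β₂ ⊖ a₁ · β₁)
    ∎)
    where
    open ≡-Reasoning
    x₁ x₂ : ℕ
    x₁ = ∣ a₁ * + x - m ∣
    x₂ = ∣ n - a₂ * + x ∣

lemma14 : (D : ℕ) → RealQuadratic D →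
          (β₁ β₂ : Elt) → IsZBasis D β₁ β₂ → InO⁺ D β₁ → InO⁺ D β₂ →
          (a₁ a₂ : ℕ) → NonZero a₁ → NonZero a₂ →
          InO⁺ D ((+ a₂) · β₂ ⊖ (+ a₁) · β₁) →
          (q r : ℕ) → r ℕ.≤ a₁ →
          (y₂ : ℤ) →
          ((0 ℕ.< r → r ℕ.< a₁ →
            (InSG₃ β₁ β₂ ((+ a₂) · β₂ ⊖ (+ a₁) · β₁)
               ((y₂ · β₂) ⊖ ((+ (a₁ ℕ.* q ℕ.+ r)) · β₁))
             ⇔ (+ ((q ℕ.+ 1) ℕ.* a₂) ℤ.≤ y₂)))
          ×
           (r ≡ 0 →
            (InSG₃ β₁ β₂ ((+ a₂) · β₂ ⊖ (+ a₁) · β₁)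
               ((y₂ · β₂) ⊖ ((+ (a₁ ℕ.* q ℕ.+ r)) · β₁))
             ⇔ (+ (q ℕ.* a₂) ℤ.≤ y₂))))
lemma14 _ _ β₁ β₂ (_ , _ , _ , indep) _ _ a₁ a₂ a₁≢0 _ _ q r r≤a₁ y₂ =
  (λ 0<r _ → SG⇔ (q ℕ.+ 1) (λ x → a*q+r≤a*x⇔q+1≤x a₁ q x 0<r r≤a₁)) ,
  λ { refl → SG⇔ q (λ x → subst (λ n → n ℕ.≤ a₁ ℕ.* x ⇔ q ℕ.≤ x) (sym (ℕP.+-identityʳ (a₁ ℕ.* q)))
                                (a*q≤a*x⇔q≤x a₁ {{a₁≢0}} q x)) }
  where
  y₁ : ℕ
  y₁ = a₁ ℕ.* q ℕ.+ r

  SG⇔ : ∀ x₀ → (∀ x → y₁ ℕ.≤ a₁ ℕ.* x ⇔ x₀ ℕ.≤ x) →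
        InSG₃ β₁ β₂ ((+ a₂) · β₂ ⊖ (+ a₁) · β₁) (y₂ · β₂ ⊖ (+ y₁) · β₁) ⇔ + (x₀ ℕ.* a₂) ≤ y₂
  SG⇔ x₀ y₁≤a₁x⇔x₀≤x = ⇔.trans (InSG₃-α⇔ indep (+ a₁) (+ a₂) (+ y₁) y₂)
    (∃-above-threshold⇔ x₀ (λ x → ⇔.trans (+≤+*+⇔≤* y₁ a₁ x) (y₁≤a₁x⇔x₀≤x x)) a₂ y₂)
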